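{- (1) For any finite poset $P$ and positive integer $n$, $\mathrm{ar}(n,P)\le 2+\mathrm{La}(n,\mathcal{P}^-(P))$. (2) If a finite poset $P$ contains a smallest or a largest element $m$, then $\mathrm{ar}^*(n,P)\le 1+\mathrm{La}^*(n,P\setminus\{m\})$.
   Context: $[n]=\{1,\dots,n\}$, $2^{[n]}$ its power set. A family $\mathcal{G}$ of sets is a weak copy of a poset $(P,\leqslant)$ if there is a bijection $f:P\to\mathcal{G}$ with $p\leqslant q\Rightarrow f(p)\subseteq f(q)$; a strong copy if there is a bijection with $p\leqslant q\iff f(p)\subseteq f(q)$. For a poset $Q$ (resp. a set $\mathcal{P}$ of posets), $\mathrm{La}(n,Q)$ / $\mathrm{La}^*(n,Q)$ (resp. $\mathrm{La}(n,\mathcal{P})$ / $\mathrm{La}^*(n,\mathcal{P})$) is the maximum size of a family $\mathcal{F}\subseteq 2^{[n]}$ containing no weak / strong copy of $Q$ (resp. of any member of $\mathcal{P}$). $\mathcal{P}^-(P)=\{P\setminus\{m\}: m \text{ maximal or minimal in } P\}$ with induced orders. $\mathrm{ar}(n,P)$ ($\mathrm{ar}^*(n,P)$) is the maximum number of colors used in a coloring of $2^{[n]}$ with no rainbow (all sets distinctly colored) weak (strong) copy of $P$. -}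

module Defs where

open import Level using (0ℓ)
open import Data.Nat using (ℕ; zero; suc; _≤_)
open import Data.Fin using (Fin; punchIn)
open import Data.Fin.Subset using (Subset; _⊆_)
open import Data.List using (List; length)
open import Data.List.Membership.Propositional using (_∈_)
open import Data.List.Relation.Unary.Unique.Propositional using (Unique)
open import Data.Product using (Σ; ∃; _×_; _,_)
open import Data.Sum using (_⊎_)
open import Data.Unit using (⊤)
open import Relation.Nullary using (¬_)
open import Relation.Binary.Core using (Rel)
open import Relation.Binary.Structures using (IsPartialOrder)
open import Relation.Binary.PropositionalEquality using (_≡_)
open import Function.Definitions using (Injective)
open import Function.Bundles using (_⇔_)

record FinPoset : Set₁ where
  field
    size : ℕ
    _≼_  : Rel (Fin size) 0ℓ
    isPartialOrder : IsPartialOrder _≡_ _≼_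
open FinPoset public

-- A family of subsets of [n]: a duplicate-free list of subsets; its size is its length.
Family : ℕ → Set
Family n = List (Subset n)

IsFamily : ∀ {n} → Family n → Set
IsFamily F = Unique F

-- F contains a weak copy of the (relation on) Fin k: an injective map into F
-- (a bijection onto its image, a subfamily of F) which is order preserving.
ContainsWeak : ∀ {n k} → Rel (Fin k) 0ℓ → Family n → Set
ContainsWeak {n} {k} R F =
  Σ (Fin k → Subset n) λ f →
    Injective _≡_ _≡_ f × (∀ i → f i ∈ F) × (∀ i j → R i j → f i ⊆ f j)

ContainsStrong : ∀ {n k} → Rel (Fin k) 0ℓ → Family n → Set
ContainsStrong {n} {k} R F =
  Σ (Fin k → Subset n) λ f →
    Injective _≡_ _≡_ f × (∀ i → f i ∈ F) × (∀ i j → R i j ⇔ (f i ⊆ f j))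

-- P \ {m} with the induced order, carrier Fin k re-indexed via punchIn m.
removeRel : ∀ {k} → Rel (Fin (suc k)) 0ℓ → Fin (suc k) → Rel (Fin k) 0ℓ
removeRel R m i j = R (punchIn m i) (punchIn m j)

IsMaximal IsMinimal IsLargest IsSmallest : ∀ {k} → Rel (Fin k) 0ℓ → Fin k → Set
IsMaximal R m = ∀ j → R m j → j ≡ m
IsMinimal R m = ∀ j → R j m → j ≡ m
IsLargest R m = ∀ j → R j m
IsSmallest R m = ∀ j → R m j

-- F contains no weak copy of any member of 𝒫⁻(P) = {P \ {m} : m maximal or minimal}.
-- (If P is empty, 𝒫⁻(P) is empty.)
FreeMinusWeak : ∀ {n} (k : ℕ) → Rel (Fin k) 0ℓ → Family n → Set
FreeMinusWeak zero    R F = ⊤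
FreeMinusWeak (suc k) R F =
  ∀ m → (IsMaximal R m ⊎ IsMinimal R m) → ¬ ContainsWeak (removeRel R m) F

IsMax : (ℕ → Set) → ℕ → Set
IsMax S a = S a × (∀ b → S b → b ≤ a)

LaMinusValues : ℕ → FinPoset → ℕ → Set
LaMinusValues n P s =
  Σ (Family n) λ F → IsFamily F × FreeMinusWeak (size P) (_≼_ P) F × length F ≡ s

LaStarValues : ∀ {k} → ℕ → Rel (Fin k) 0ℓ → ℕ → Set
LaStarValues n R s =
  Σ (Family n) λ F → IsFamily F × ¬ ContainsStrong R F × length F ≡ s

Coloring : ℕ → Set
Coloring n = Subset n → ℕ

NumColors : ∀ {n} → Coloring n → ℕ → Set
NumColors {n} c a =
  Σ (List ℕ) λ L → Unique L × (∀ x → x ∈ L → ∃ λ S → c S ≡ x)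
                 × (∀ S → c S ∈ L) × length L ≡ a

-- rainbow weak / strong copy of P in 2^[n] under c (distinct colours ⇒ distinct sets)
RainbowWeak : ∀ {n} → FinPoset → Coloring n → Set
RainbowWeak {n} P c =
  Σ (Fin (size P) → Subset n) λ f →
    Injective _≡_ _≡_ (λ i → c (f i)) × (∀ i j → _≼_ P i j → f i ⊆ f j)

RainbowStrong : ∀ {n} → FinPoset → Coloring n → Set
RainbowStrong {n} P c =
  Σ (Fin (size P) → Subset n) λ f →
    Injective _≡_ _≡_ (λ i → c (f i)) × (∀ i j → _≼_ P i j ⇔ (f i ⊆ f j))

ArValues ArStarValues : ℕ → FinPoset → ℕ → Set
ArValues n P a = Σ (Coloring n) λ c → ¬ RainbowWeak P c × NumColors c a
ArStarValues n P a = Σ (Coloring n) λ c → ¬ RainbowStrong P c × NumColors c a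

LaStarRemoveValues : ℕ → (P : FinPoset) → Fin (size P) → ℕ → Set
LaStarRemoveValues n P m = go (size P) (_≼_ P) m
  where
    go : (k : ℕ) → Rel (Fin k) 0ℓ → Fin k → ℕ → Set
    go (suc k) R m = LaStarValues n (removeRel R m)

-- Let c colour 2^[n] without a rainbow weak copy of P.  Picking one set of every
-- colour except those of ∅ and [n] gives at least (#colours − 2) sets with
-- pairwise distinct colours.  They contain no weak copy of P ∖ {m} for m maximal
-- (minimal): adding [n] (resp. ∅), whose colour is new, at m would give a
-- rainbow weak copy of P.  For strong copies with m largest (smallest) only the
-- colour of [n] (∅) has to be removed: [n] then lies above every set of the copy
-- and, lacking its colour, equals none of them, which is exactly how m sits in P.
module Submission where

open import Defs
open import Data.Nat using (ℕ; _≤_; _+_)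
open import Data.Fin using (Fin)
open import Data.Product using (_×_)
open import Data.Sum using (_⊎_)

open import Level using (0ℓ)
open import Data.Nat as ℕ using (suc; z≤n; s≤s)
open import Data.Nat.Properties as ℕP using (≤-refl; ≤-reflexive; ≤-trans; +-monoʳ-≤; +-suc)
open import Data.Fin as Fin using (punchIn; punchOut)
open import Data.Fin.Properties using (punchIn-punchOut; punchInᵢ≢i)
open import Data.Fin.Subset using (Subset; _⊆_; ⊥; ⊤)
open import Data.Fin.Subset.Properties using (⊥⊆; ⊆⊤; ⊆-antisym)
open import Data.List using (List; []; _∷_; map; filter; foldr; length)
open import Data.List.Properties using (length-map; filter-all)
open import Data.List.Membership.Propositional using (_∈_)
open import Data.List.Membership.Propositional.Properties using (∈-map⁺; ∈-filter⁻)
open import Data.List.Relation.Unary.Any using (here; there)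
open import Data.List.Relation.Unary.All as All using (All; []; _∷_)
import Data.List.Relation.Unary.All.Properties as AllP
open import Data.List.Relation.Unary.Unique.Propositional using (Unique; []; _∷_)
open import Data.List.Relation.Unary.Unique.Propositional.Properties using (map⁻; filter⁺)
open import Data.Product using (Σ; ∃; _,_; proj₁; proj₂)
open import Data.Sum using (inj₁; inj₂)
open import Data.Vec.Functional using (insertAt)
open import Data.Vec.Functional.Properties using (insertAt-lookup; insertAt-punchIn)
open import Function using (_∘_)
open import Function.Bundles using (_⇔_; mk⇔)
open import Function.Definitions using (Injective)
open import Relation.Nullary using (¬_; yes; no; ¬?; contradiction)
open import Relation.Binary.Core using (Rel)
open import Relation.Binary.Definitions using (DecidableEquality)
open import Relation.Binary.Structures using (IsPartialOrder)
open import Relation.Binary.PropositionalEquality using (_≡_; _≢_; refl; sym; trans; cong; cong₂; subst; subst₂)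

module _ {A : Set} (_≟_ : DecidableEquality A) where

  without : A → List A → List A
  without x = filter (λ y → ¬? (x ≟ y))

  withoutAll : List A → List A → List A
  withoutAll xs L = foldr without L xs

  withoutAll⁺ : ∀ xs {L} → Unique L → Unique (withoutAll xs L)
  withoutAll⁺ []       uL = uL
  withoutAll⁺ (x ∷ xs) uL = filter⁺ (λ y → ¬? (x ≟ y)) (withoutAll⁺ xs uL)

  ∈-withoutAll⁻ : ∀ xs {L y} → y ∈ withoutAll xs L → y ∈ L × All (_≢ y) xs
  ∈-withoutAll⁻ []       y∈ = y∈ , []
  ∈-withoutAll⁻ (x ∷ xs) y∈ with ∈-filter⁻ (λ y → ¬? (x ≟ y)) y∈
  ... | y∈′ , x≢y with ∈-withoutAll⁻ xs y∈′
  ...   | y∈L , xs≢y = y∈L , x≢y ∷ xs≢y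

  length-without : ∀ x {L} → Unique L → length L ≤ suc (length (without x L))
  length-without x {[]}    []         = z≤n
  length-without x {y ∷ L} (y∉L ∷ uL) with x ≟ y
  ... | yes refl = s≤s (≤-reflexive (cong length (sym (filter-all (λ z → ¬? (x ≟ z)) y∉L))))
  ... | no _     = s≤s (length-without x uL)

  length-withoutAll : ∀ xs {L} → Unique L → length L ≤ length xs + length (withoutAll xs L)
  length-withoutAll []       uL = ≤-refl
  length-withoutAll (x ∷ xs) uL = ≤-trans (length-withoutAll xs uL) (begin
    length xs + length (withoutAll xs _)                   ≤⟨ +-monoʳ-≤ (length xs) (length-without x (withoutAll⁺ xs uL)) ⟩
    length xs + suc (length (without x (withoutAll xs _))) ≡⟨ +-suc (length xs) _ ⟩
    suc (length xs + length (withoutAll (x ∷ xs) _))       ∎)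
    where open ℕP.≤-Reasoning

module _ {n : ℕ} (c : Coloring n) where

  Realised : List ℕ → Set
  Realised L = ∀ x → x ∈ L → ∃ λ S → c S ≡ x

  representatives : ∀ L → Realised L → Σ (Family n) λ F → map c F ≡ L
  representatives []       _       = [] , refl
  representatives (x ∷ L) realised with realised x (here refl)
                                      | representatives L (λ y → realised y ∘ there)
  ... | S , cS≡x | F , cF≡L = S ∷ F , cong₂ _∷_ cS≡x cF≡L

  Unique-map⇒injectiveOn : ∀ {F S T} → Unique (map c F) → S ∈ F → T ∈ F → c S ≡ c T → S ≡ T
  Unique-map⇒injectiveOn _          (here refl) (here refl) _     = refl
  Unique-map⇒injectiveOn (cS∉ ∷ _)  (here refl) (there T∈)  cS≡cT = contradiction cS≡cT (All.lookup cS∉ (∈-map⁺ c T∈))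
  Unique-map⇒injectiveOn (cT∉ ∷ _)  (there S∈)  (here refl) cS≡cT = contradiction (sym cS≡cT) (All.lookup cT∉ (∈-map⁺ c S∈))
  Unique-map⇒injectiveOn (_ ∷ uF)   (there S∈)  (there T∈)  cS≡cT = Unique-map⇒injectiveOn uF S∈ T∈ cS≡cT

  rainbowFamily-avoiding : ∀ {a} → NumColors c a → (Ts : List (Subset n)) →
    Σ (Family n) λ F → Unique (map c F)
                     × (∀ {S} → S ∈ F → All (λ T → c T ≢ c S) Ts)
                     × a ≤ length Ts + length F
  rainbowFamily-avoiding (L , uL , realised , _ , refl) Ts
    with representatives (withoutAll ℕ._≟_ (map c Ts) L)
                         (λ x → realised x ∘ proj₁ ∘ ∈-withoutAll⁻ ℕ._≟_ (map c Ts))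
  ... | F , cF≡L′ = F , subst Unique (sym cF≡L′) (withoutAll⁺ ℕ._≟_ (map c Ts) uL)
                  , avoids , bound
    where
    avoids : ∀ {S} → S ∈ F → All (λ T → c T ≢ c S) Ts
    avoids S∈F = AllP.map⁻ (proj₂ (∈-withoutAll⁻ ℕ._≟_ (map c Ts) (subst (c _ ∈_) cF≡L′ (∈-map⁺ c S∈F))))

    bound : length L ≤ length Ts + length F
    bound = subst₂ (λ t f → length L ≤ t + f) (length-map c Ts) (trans (cong length (sym cF≡L′)) (length-map c F))
                   (length-withoutAll ℕ._≟_ (map c Ts) uL)

module _ {A : Set} {k : ℕ} (f : Fin k → A) (m : Fin (suc k)) (x : A) where

  insertAt-elim : (Z : Fin (suc k) → A → Set) → Z m x → (∀ i → Z (punchIn m i) (f i)) →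
                  ∀ j → Z j (insertAt f m x j)
  insertAt-elim Z zm zi j with m Fin.≟ j
  ... | yes refl = subst (Z m) (sym (insertAt-lookup f m x)) zm
  ... | no m≢j   = subst (λ j → Z j (insertAt f m x j)) (punchIn-punchOut m≢j)
                         (subst (Z _) (sym (insertAt-punchIn f m x (punchOut m≢j))) (zi (punchOut m≢j)))

  insertAt-elim₂ : (Z : Fin (suc k) → Fin (suc k) → A → A → Set) →
                   Z m m x x → (∀ j → Z m (punchIn m j) x (f j)) → (∀ i → Z (punchIn m i) m (f i) x) →
                   (∀ i j → Z (punchIn m i) (punchIn m j) (f i) (f j)) →
                   ∀ i j → Z i j (insertAt f m x i) (insertAt f m x j)
  insertAt-elim₂ Z zmm zmj zim zij =
    insertAt-elim (λ i y → ∀ j → Z i j y (insertAt f m x j))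
      (insertAt-elim (λ j → Z m j x) zmm zmj)
      (λ i → insertAt-elim (λ j → Z (punchIn m i) j (f i)) (zim i) (zij i))

module _ {n k : ℕ} {R : Rel (Fin (suc k)) 0ℓ} {m : Fin (suc k)} {f : Fin k → Subset n} where

  insertAt-⊤-monotone : IsMaximal R m → (∀ i j → removeRel R m i j → f i ⊆ f j) →
                        ∀ i j → R i j → insertAt f m ⊤ i ⊆ insertAt f m ⊤ j
  insertAt-⊤-monotone maximal mono = insertAt-elim₂ f m ⊤ (λ i j A B → R i j → A ⊆ B)
    (λ _ {_} x∈ → x∈) (λ j Rmj → contradiction (maximal _ Rmj) (punchInᵢ≢i m j)) (λ _ _ → ⊆⊤) mono

  insertAt-⊥-monotone : IsMinimal R m → (∀ i j → removeRel R m i j → f i ⊆ f j) →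
                        ∀ i j → R i j → insertAt f m ⊥ i ⊆ insertAt f m ⊥ j
  insertAt-⊥-monotone minimal mono = insertAt-elim₂ f m ⊥ (λ i j A B → R i j → A ⊆ B)
    (λ _ {_} x∈ → x∈) (λ _ _ → ⊥⊆) (λ i Rim → contradiction (minimal _ Rim) (punchInᵢ≢i m i)) mono

  module _ (po : IsPartialOrder _≡_ R) where
    open IsPartialOrder po using (antisym) renaming (refl to R-refl)

    insertAt-⊤-embedding : IsLargest R m → (∀ i → f i ≢ ⊤) → (∀ i j → removeRel R m i j ⇔ (f i ⊆ f j)) →
                           ∀ i j → R i j ⇔ (insertAt f m ⊤ i ⊆ insertAt f m ⊤ j)
    insertAt-⊤-embedding largest f≢⊤ emb = insertAt-elim₂ f m ⊤ (λ i j A B → R i j ⇔ (A ⊆ B))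
      (mk⇔ (λ _ {_} x∈ → x∈) (λ _ → R-refl))
      (λ j → mk⇔ (λ Rmj → contradiction (antisym (largest _) Rmj) (punchInᵢ≢i m j))
                 (λ (⊤⊆fj : ⊤ ⊆ f j) → contradiction (⊆-antisym ⊆⊤ ⊤⊆fj) (f≢⊤ j)))
      (λ i → mk⇔ (λ _ {_} → ⊆⊤) (λ _ → largest _))
      emb

    insertAt-⊥-embedding : IsSmallest R m → (∀ i → f i ≢ ⊥) → (∀ i j → removeRel R m i j ⇔ (f i ⊆ f j)) →
                           ∀ i j → R i j ⇔ (insertAt f m ⊥ i ⊆ insertAt f m ⊥ j)
    insertAt-⊥-embedding smallest f≢⊥ emb = insertAt-elim₂ f m ⊥ (λ i j A B → R i j ⇔ (A ⊆ B))
      (mk⇔ (λ _ {_} x∈ → x∈) (λ _ → R-refl))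
      (λ j → mk⇔ (λ _ {_} → ⊥⊆) (λ _ → smallest _))
      (λ i → mk⇔ (λ Rim → contradiction (antisym Rim (smallest _)) (punchInᵢ≢i m i))
                 (λ (fi⊆⊥ : f i ⊆ ⊥) → contradiction (⊆-antisym fi⊆⊥ ⊥⊆) (f≢⊥ i)))
      emb

insertAt-rainbow : ∀ {n k} (c : Coloring n) {F} {f : Fin k → Subset n} →
                   Unique (map c F) → Injective _≡_ _≡_ f → (∀ i → f i ∈ F) →
                   ∀ m {T} → (∀ {S} → S ∈ F → c T ≢ c S) → Injective _≡_ _≡_ (c ∘ insertAt f m T)
insertAt-rainbow c {F} {f} uF f-inj f∈F m {T} avoids {i} {j} =
  insertAt-elim₂ f m T (λ i j A B → c A ≡ c B → i ≡ j)
    (λ _ → refl)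
    (λ j cT≡cfj → contradiction cT≡cfj (avoids (f∈F j)))
    (λ i cfi≡cT → contradiction (sym cfi≡cT) (avoids (f∈F i)))
    (λ i j cfi≡cfj → cong (punchIn m) (f-inj (Unique-map⇒injectiveOn c uF (f∈F i) (f∈F j) cfi≡cfj)))
    i j

HasRainbowWeakCopy HasRainbowStrongCopy : ∀ {n k} → Rel (Fin k) 0ℓ → Coloring n → Set
HasRainbowWeakCopy {n} {k} R c =
  Σ (Fin k → Subset n) λ g → Injective _≡_ _≡_ (c ∘ g) × (∀ i j → R i j → g i ⊆ g j)
HasRainbowStrongCopy {n} {k} R c =
  Σ (Fin k → Subset n) λ g → Injective _≡_ _≡_ (c ∘ g) × (∀ i j → R i j ⇔ (g i ⊆ g j))

freeMinusWeak : ∀ {n} (c : Coloring n) {F} → Unique (map c F) →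
                (∀ {S} → S ∈ F → All (λ T → c T ≢ c S) (⊥ ∷ ⊤ ∷ [])) →
                ∀ k (R : Rel (Fin k) 0ℓ) → ¬ HasRainbowWeakCopy R c → FreeMinusWeak k R F
freeMinusWeak c uF avoids ℕ.zero  R noRainbow = _
freeMinusWeak c uF avoids (suc k) R noRainbow m (inj₁ maximal) (f , f-inj , f∈F , mono) =
  noRainbow (insertAt f m ⊤ , insertAt-rainbow c uF f-inj f∈F m (λ S∈F → All.lookup (avoids S∈F) (there (here refl)))
                            , insertAt-⊤-monotone maximal mono)
freeMinusWeak c uF avoids (suc k) R noRainbow m (inj₂ minimal) (f , f-inj , f∈F , mono) =
  noRainbow (insertAt f m ⊥ , insertAt-rainbow c uF f-inj f∈F m (λ S∈F → All.lookup (avoids S∈F) (here refl))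
                            , insertAt-⊥-monotone minimal mono)

extremal : ∀ {n} {A B : Set} → A ⊎ B → Subset n
extremal (inj₁ _) = ⊥
extremal (inj₂ _) = ⊤

freeRemovedStrong : ∀ {n k} (c : Coloring n) {F} → Unique (map c F) →
                    {R : Rel (Fin (suc k)) 0ℓ} → IsPartialOrder _≡_ R →
                    ∀ m (e : IsSmallest R m ⊎ IsLargest R m) → (∀ {S} → S ∈ F → c (extremal e) ≢ c S) →
                    ¬ HasRainbowStrongCopy R c → ¬ ContainsStrong (removeRel R m) F
freeRemovedStrong c uF po m (inj₁ smallest) avoids noRainbow (f , f-inj , f∈F , emb) =
  noRainbow (insertAt f m ⊥ , insertAt-rainbow c uF f-inj f∈F m avoids
                            , insertAt-⊥-embedding po smallest (λ i fi≡⊥ → avoids (f∈F i) (cong c (sym fi≡⊥))) emb)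
freeRemovedStrong c uF po m (inj₂ largest) avoids noRainbow (f , f-inj , f∈F , emb) =
  noRainbow (insertAt f m ⊤ , insertAt-rainbow c uF f-inj f∈F m avoids
                            , insertAt-⊤-embedding po largest (λ i fi≡⊤ → avoids (f∈F i) (cong c (sym fi≡⊤))) emb)

ar≤2+La⁻ : ∀ (P : FinPoset) (n : ℕ) → 1 ≤ n → ∀ a l →
           IsMax (ArValues n P) a → IsMax (LaMinusValues n P) l → a ≤ 2 + l
ar≤2+La⁻ P n _ a l ((c , noRainbow , colours) , _) (_ , La-max)
  with rainbowFamily-avoiding c colours (⊥ ∷ ⊤ ∷ [])
... | F , uF , avoids , a≤2+|F| =
  ≤-trans a≤2+|F| (+-monoʳ-≤ 2 (La-max (length F)
    (F , map⁻ uF , freeMinusWeak c uF avoids (size P) (_≼_ P) noRainbow , refl)))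

ar*≤1+La* : ∀ (P : FinPoset) (m : Fin (size P)) →
            (IsSmallest (_≼_ P) m ⊎ IsLargest (_≼_ P) m) →
            ∀ (n : ℕ) → 1 ≤ n → ∀ a l →
            IsMax (ArStarValues n P) a → IsMax (LaStarRemoveValues n P m) l → a ≤ 1 + l
ar*≤1+La* record { size = suc k ; _≼_ = R ; isPartialOrder = po } m e n _ a l
          ((c , noRainbow , colours) , _) (_ , La-max)
  with rainbowFamily-avoiding c colours (extremal e ∷ [])
... | F , uF , avoids , a≤1+|F| =
  ≤-trans a≤1+|F| (+-monoʳ-≤ 1 (La-max (length F)
    (F , map⁻ uF , freeRemovedStrong c uF po m e (All.head ∘ avoids) noRainbow , refl)))

proposition1p2 :
    (∀ (P : FinPoset) (n : ℕ) → 1 ≤ n → ∀ a l →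
       IsMax (ArValues n P) a → IsMax (LaMinusValues n P) l → a ≤ 2 + l)
    ×
    (∀ (P : FinPoset) (m : Fin (size P)) →
       (IsSmallest (_≼_ P) m ⊎ IsLargest (_≼_ P) m) →
       ∀ (n : ℕ) → 1 ≤ n → ∀ a l →
       IsMax (ArStarValues n P) a → IsMax (LaStarRemoveValues n P m) l → a ≤ 1 + l)
proposition1p2 = ar≤2+La⁻ , ar*≤1+La*
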